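{- For every integer $n\geq 1$, \[ \sum_{k=1}^n \frac{2^{ -2k}}{2k-1} \frac{\binom{2k}{k}}{k+1} H_{k+1} = \frac{5}{9} - \frac{2^{ -2n}}{3(n+1)} \binom{2n}{n} \left ( H_{n+1} + \frac{2}{3}\right ) \] and \[ \sum_{k=1}^n \frac{2^{ -2k}}{2k-1} \frac{\binom{2k}{k}}{(k+1)(k+2)} H_{k+2} = \frac{19}{100} - \frac{2^{ -2n}}{5(n+1)(n+2)} \binom{2n}{n} \left ( H_{n+2} + \frac{2}{5}\right ). \]
   Context: $H_n=\sum_{j=1}^n 1/j$ denotes the $n$-th harmonic number. -}

module Defs where

open import Data.Nat as ℕ using (ℕ; zero; suc)
open import Data.Nat.Combinatorics using (_C_)
open import Data.Integer using (+_)
open import Data.Rational using (ℚ; _/_; _+_; _*_; _-_; 0ℚ; 1ℚ)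

H : ℕ → ℚ
H zero = 0ℚ
H (suc n) = H n + (+ 1) / suc n

_^ℚ_ : ℚ → ℕ → ℚ
q ^ℚ zero = 1ℚ
q ^ℚ suc n = q * (q ^ℚ n)

pow2neg2 : ℕ → ℚ
pow2neg2 k = ((+ 1) / 4) ^ℚ k

binomℚ : ℕ → ℕ → ℚ
binomℚ n k = (+ (n C k)) / 1

Σ₁ : ℕ → (ℕ → ℚ) → ℚ
Σ₁ zero f = 0ℚ
Σ₁ (suc n) f = Σ₁ n f + f (suc n)

-- k-th summand of the first sum, for k ≥ 1 (k = suc i, so 2k-1 = suc (2 i)):
--   2^{-2k}/(2k-1) * binom(2k,k)/(k+1) * H_{k+1}
term₁ : ℕ → ℚ
term₁ zero = 0ℚ
term₁ (suc i) =
  pow2neg2 (suc i) * ((+ 1) / suc (2 ℕ.* i))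
    * (binomℚ (2 ℕ.* suc i) (suc i) * ((+ 1) / (2 ℕ.+ i)))
    * H (2 ℕ.+ i)

term₂ : ℕ → ℚ
term₂ zero = 0ℚ
term₂ (suc i) =
  pow2neg2 (suc i) * ((+ 1) / suc (2 ℕ.* i))
    * (binomℚ (2 ℕ.* suc i) (suc i) * ((+ 1) / ((2 ℕ.+ i) ℕ.* (3 ℕ.+ i))))
    * H (3 ℕ.+ i)

-- Both right-hand sides F satisfy F 0 = 0 and F n + term (n + 1) = F (n + 1), so the sums telescope.
-- Using (n+1)·C(2n+2,n+1) = 2(2n+1)·C(2n,n) and H_{n+2} = H_{n+1} + 1/(n+2), and writing u, v, w, x
-- for the reciprocals of n+1, n+2, 2n+1, n+3 and M for 2n+1, the step becomes a polynomial identity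
-- modulo the relations M w = 1, M v + 3 v = 2 and x + v x = v; it is checked by the ring solver on an
-- explicit combination of these relations.
module Submission where

open import Defs
open import Data.Nat as ℕ using (ℕ; zero; suc; _≥_; NonZero)
open import Data.Nat.Combinatorics using (_C_; nC1≡n; nCk+nC[k+1]≡[n+1]C[k+1]; nCk≡nC[n∸k])
open import Data.Nat.Properties
  using (*-zeroʳ; *-identityˡ; *-identityʳ; *-distribˡ-+; +-assoc; *-assoc; *-comm; m≤n+m; m+n∸n≡m; m*n≢0)
import Data.Nat.Tactic.RingSolver as ℕ-Solver
open import Data.Integer as ℤ using (+_)
open import Data.Integer.Properties using (pos-*; pos-+)
open import Data.Rational using (ℚ; _/_; _+_; _*_; _-_; 0ℚ; 1ℚ; toℚᵘ)
open import Data.Rational.Properties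
  using (_≟_; +-*-commutativeRing; toℚᵘ-injective; toℚᵘ-fromℚᵘ; toℚᵘ-homo-*; toℚᵘ-homo-+)
import Data.Rational.Unnormalised as ℚᵘ
import Data.Rational.Unnormalised.Properties as ℚᵘ
open import Data.Product using (_×_; _,_)
open import Data.List using (_∷_; [])
open import Level using (0ℓ)
open import Relation.Nullary.Decidable using (dec⇒maybe)
open import Relation.Binary.PropositionalEquality using (_≡_; refl; sym; trans; cong; cong₂; module ≡-Reasoning)
open import Tactic.RingSolver using (solve-∀; solve)
open import Tactic.RingSolver.Core.AlmostCommutativeRing using (AlmostCommutativeRing; fromCommutativeRing)

ℚ-ring : AlmostCommutativeRing 0ℓ 0ℓ
ℚ-ring = fromCommutativeRing +-*-commutativeRing (λ p → dec⇒maybe (0ℚ ≟ p))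

[1+k]*[1+n]C[1+k]≡[1+n]*nCk : ∀ n k → suc k ℕ.* (suc n C suc k) ≡ suc n ℕ.* (n C k)
[1+k]*[1+n]C[1+k]≡[1+n]*nCk zero    zero    = refl
[1+k]*[1+n]C[1+k]≡[1+n]*nCk zero    (suc k) = *-zeroʳ (suc (suc k))
[1+k]*[1+n]C[1+k]≡[1+n]*nCk (suc n) zero    =
  trans (*-identityˡ _) (trans (nC1≡n (suc (suc n))) (sym (*-identityʳ _)))
[1+k]*[1+n]C[1+k]≡[1+n]*nCk (suc n) (suc k) = begin
  suc (suc k) ℕ.* (suc (suc n) C suc (suc k))
    ≡⟨ cong (suc (suc k) ℕ.*_) (sym (nCk+nC[k+1]≡[n+1]C[k+1] (suc n) (suc k))) ⟩
  suc (suc k) ℕ.* (a ℕ.+ b)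
    ≡⟨ *-distribˡ-+ (suc (suc k)) a b ⟩
  (a ℕ.+ suc k ℕ.* a) ℕ.+ suc (suc k) ℕ.* b
    ≡⟨ cong₂ (λ x y → (a ℕ.+ x) ℕ.+ y)
             ([1+k]*[1+n]C[1+k]≡[1+n]*nCk n k) ([1+k]*[1+n]C[1+k]≡[1+n]*nCk n (suc k)) ⟩
  (a ℕ.+ suc n ℕ.* (n C k)) ℕ.+ suc n ℕ.* (n C suc k)
    ≡⟨ +-assoc a _ _ ⟩
  a ℕ.+ (suc n ℕ.* (n C k) ℕ.+ suc n ℕ.* (n C suc k))
    ≡⟨ cong (a ℕ.+_) (sym (*-distribˡ-+ (suc n) (n C k) (n C suc k))) ⟩
  a ℕ.+ suc n ℕ.* (n C k ℕ.+ n C suc k)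
    ≡⟨ cong (λ x → a ℕ.+ suc n ℕ.* x) (nCk+nC[k+1]≡[n+1]C[k+1] n k) ⟩
  a ℕ.+ suc n ℕ.* a ∎
  where
  open ≡-Reasoning
  a = suc n C suc k
  b = suc n C suc (suc k)

[1+n]*[2+2n]C[1+n]≡2*[1+2n]*[2n]Cn : ∀ n →
  suc n ℕ.* (2 ℕ.* suc n C suc n) ≡ 2 ℕ.* suc (2 ℕ.* n) ℕ.* (2 ℕ.* n C n)
[1+n]*[2+2n]C[1+n]≡2*[1+2n]*[2n]Cn n = begin
  suc n ℕ.* (2 ℕ.* suc n C suc n)
    ≡⟨ cong (λ m → suc n ℕ.* (m C suc n)) (sym 2+2n≡2*[1+n]) ⟩
  suc n ℕ.* (suc (suc (2 ℕ.* n)) C suc n)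
    ≡⟨ [1+k]*[1+n]C[1+k]≡[1+n]*nCk (suc (2 ℕ.* n)) n ⟩
  suc (suc (2 ℕ.* n)) ℕ.* (suc (2 ℕ.* n) C n)
    ≡⟨ cong₂ ℕ._*_ 2+2n≡2*[1+n] [1+2n]Cn≡[1+2n]C[1+n] ⟩
  2 ℕ.* suc n ℕ.* (suc (2 ℕ.* n) C suc n)
    ≡⟨ *-assoc 2 (suc n) _ ⟩
  2 ℕ.* (suc n ℕ.* (suc (2 ℕ.* n) C suc n))
    ≡⟨ cong (2 ℕ.*_) ([1+k]*[1+n]C[1+k]≡[1+n]*nCk (2 ℕ.* n) n) ⟩
  2 ℕ.* (suc (2 ℕ.* n) ℕ.* (2 ℕ.* n C n))
    ≡⟨ *-assoc 2 (suc (2 ℕ.* n)) _ ⟨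
  2 ℕ.* suc (2 ℕ.* n) ℕ.* (2 ℕ.* n C n) ∎
  where
  open ≡-Reasoning
  2+2n≡2*[1+n] : suc (suc (2 ℕ.* n)) ≡ 2 ℕ.* suc n
  2+2n≡2*[1+n] = ℕ-Solver.solve (n ∷ [])
  1+2n≡[1+n]+n : suc (2 ℕ.* n) ≡ suc n ℕ.+ n
  1+2n≡[1+n]+n = ℕ-Solver.solve (n ∷ [])
  [1+2n]Cn≡[1+2n]C[1+n] : suc (2 ℕ.* n) C n ≡ suc (2 ℕ.* n) C suc n
  [1+2n]Cn≡[1+2n]C[1+n] = begin
    suc (2 ℕ.* n) C n                   ≡⟨ cong (_C n) 1+2n≡[1+n]+n ⟩
    (suc n ℕ.+ n) C n                   ≡⟨ nCk≡nC[n∸k] (m≤n+m n (suc n)) ⟩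
    (suc n ℕ.+ n) C (suc n ℕ.+ n ℕ.∸ n) ≡⟨ cong₂ _C_ (sym 1+2n≡[1+n]+n) (m+n∸n≡m (suc n) n) ⟩
    suc (2 ℕ.* n) C suc n               ∎

toℚᵘ-/ : ∀ i b → toℚᵘ (i / suc b) ℚᵘ.≃ ℚᵘ.mkℚᵘ i b
toℚᵘ-/ i b = toℚᵘ-fromℚᵘ (ℚᵘ.mkℚᵘ i b)

ad≡cb⇒a/b≡c/d : ∀ a b c d .{{_ : NonZero b}} .{{_ : NonZero d}} →
                a ℕ.* d ≡ c ℕ.* b → (+ a) / b ≡ (+ c) / d
ad≡cb⇒a/b≡c/d a (suc b) c (suc d) ad≡cb = toℚᵘ-injective (begin
  toℚᵘ ((+ a) / suc b) ≈⟨ toℚᵘ-/ (+ a) b ⟩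
  ℚᵘ.mkℚᵘ (+ a) b      ≈⟨ ℚᵘ.*≡* cross ⟩
  ℚᵘ.mkℚᵘ (+ c) d      ≈⟨ toℚᵘ-/ (+ c) d ⟨
  toℚᵘ ((+ c) / suc d) ∎)
  where
  open ℚᵘ.≃-Reasoning
  cross : + a ℤ.* + suc d ≡ + c ℤ.* + suc b
  cross = trans (sym (pos-* a (suc d))) (trans (cong +_ ad≡cb) (pos-* c (suc b)))

a/b*c/d≡ac/bd : ∀ a b c d .{{_ : NonZero b}} .{{_ : NonZero d}} →
                (+ a) / b * ((+ c) / d) ≡ ((+ (a ℕ.* c)) / (b ℕ.* d)) {{m*n≢0 b d}}
a/b*c/d≡ac/bd a (suc b) c (suc d) = toℚᵘ-injective (begin
  toℚᵘ ((+ a) / suc b * ((+ c) / suc d))          ≈⟨ toℚᵘ-homo-* ((+ a) / suc b) ((+ c) / suc d) ⟩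
  toℚᵘ ((+ a) / suc b) ℚᵘ.* toℚᵘ ((+ c) / suc d) ≈⟨ ℚᵘ.*-cong (toℚᵘ-/ (+ a) b) (toℚᵘ-/ (+ c) d) ⟩
  ℚᵘ.mkℚᵘ (+ a) b ℚᵘ.* ℚᵘ.mkℚᵘ (+ c) d            ≡⟨ cong (λ i → ℚᵘ.mkℚᵘ i _) (sym (pos-* a c)) ⟩
  ℚᵘ.mkℚᵘ (+ (a ℕ.* c)) _                         ≈⟨ toℚᵘ-/ (+ (a ℕ.* c)) _ ⟨
  toℚᵘ ((+ (a ℕ.* c)) / (suc b ℕ.* suc d))        ∎)
  where open ℚᵘ.≃-Reasoning

a/b+c/d≡[ad+cb]/bd : ∀ a b c d .{{_ : NonZero b}} .{{_ : NonZero d}} →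
                     (+ a) / b + (+ c) / d ≡ ((+ (a ℕ.* d ℕ.+ c ℕ.* b)) / (b ℕ.* d)) {{m*n≢0 b d}}
a/b+c/d≡[ad+cb]/bd a (suc b) c (suc d) = toℚᵘ-injective (begin
  toℚᵘ ((+ a) / suc b + (+ c) / suc d)            ≈⟨ toℚᵘ-homo-+ ((+ a) / suc b) ((+ c) / suc d) ⟩
  toℚᵘ ((+ a) / suc b) ℚᵘ.+ toℚᵘ ((+ c) / suc d) ≈⟨ ℚᵘ.+-cong (toℚᵘ-/ (+ a) b) (toℚᵘ-/ (+ c) d) ⟩
  ℚᵘ.mkℚᵘ (+ a) b ℚᵘ.+ ℚᵘ.mkℚᵘ (+ c) d            ≡⟨ cong (λ i → ℚᵘ.mkℚᵘ i _) (sym numerator) ⟩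
  ℚᵘ.mkℚᵘ (+ (ad+cb)) _                           ≈⟨ toℚᵘ-/ (+ (ad+cb)) _ ⟨
  toℚᵘ ((+ (ad+cb)) / (suc b ℕ.* suc d))          ∎)
  where
  open ℚᵘ.≃-Reasoning
  ad+cb = a ℕ.* suc d ℕ.+ c ℕ.* suc b
  numerator : + ad+cb ≡ + a ℤ.* + suc d ℤ.+ + c ℤ.* + suc b
  numerator = trans (pos-+ (a ℕ.* suc d) (c ℕ.* suc b)) (cong₂ ℤ._+_ (pos-* a (suc d)) (pos-* c (suc b)))

[1+d]*1/[1+d]≡1 : ∀ d → (+ suc d) / 1 * ((+ 1) / suc d) ≡ 1ℚ
[1+d]*1/[1+d]≡1 d =
  trans (a/b*c/d≡ac/bd (suc d) 1 1 (suc d))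
        (ad≡cb⇒a/b≡c/d (suc d ℕ.* 1) (1 ℕ.* suc d) 1 1 (ℕ-Solver.solve (d ∷ [])))

1/[2+d]+1/[1+d]*1/[2+d]≡1/[1+d] : ∀ d →
  (+ 1) / suc (suc d) + (+ 1) / suc d * ((+ 1) / suc (suc d)) ≡ (+ 1) / suc d
1/[2+d]+1/[1+d]*1/[2+d]≡1/[1+d] d =
  trans (cong (λ q → (+ 1) / suc (suc d) + q) (a/b*c/d≡ac/bd 1 (suc d) 1 (suc (suc d))))
  (trans (a/b+c/d≡[ad+cb]/bd 1 (suc (suc d)) 1 (suc d ℕ.* suc (suc d)))
         (ad≡cb⇒a/b≡c/d (1 ℕ.* (suc d ℕ.* suc (suc d)) ℕ.+ 1 ℕ.* suc (suc d))
                        (suc (suc d) ℕ.* (suc d ℕ.* suc (suc d))) 1 (suc d)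
                        (ℕ-Solver.solve (d ∷ []))))

[1+2n]/[2+n]+3/[2+n]≡2 : ∀ n →
  (+ suc (2 ℕ.* n)) / 1 * ((+ 1) / suc (suc n)) + (+ 3) / 1 * ((+ 1) / suc (suc n)) ≡ (+ 2) / 1
[1+2n]/[2+n]+3/[2+n]≡2 n =
  trans (cong₂ _+_ (a/b*c/d≡ac/bd (suc (2 ℕ.* n)) 1 1 (suc (suc n))) (a/b*c/d≡ac/bd 3 1 1 (suc (suc n))))
  (trans (a/b+c/d≡[ad+cb]/bd (suc (2 ℕ.* n) ℕ.* 1) (1 ℕ.* suc (suc n)) (3 ℕ.* 1) (1 ℕ.* suc (suc n)))
         (ad≡cb⇒a/b≡c/d (suc (2 ℕ.* n) ℕ.* 1 ℕ.* (1 ℕ.* suc (suc n))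
                           ℕ.+ 3 ℕ.* 1 ℕ.* (1 ℕ.* suc (suc n)))
                        (1 ℕ.* suc (suc n) ℕ.* (1 ℕ.* suc (suc n))) 2 1
                        (ℕ-Solver.solve (n ∷ []))))

binomℚ[2+2n,1+n]≡2*[1+2n]*binomℚ[2n,n]/[1+n] : ∀ n →
  binomℚ (2 ℕ.* suc n) (suc n) ≡ (+ 2) / 1 * ((+ suc (2 ℕ.* n)) / 1) * ((+ 1) / suc n) * binomℚ (2 ℕ.* n) n
binomℚ[2+2n,1+n]≡2*[1+2n]*binomℚ[2n,n]/[1+n] n = sym (begin
  (+ 2) / 1 * ((+ suc (2 ℕ.* n)) / 1) * ((+ 1) / suc n) * ((+ c) / 1)
    ≡⟨ cong (λ q → q * ((+ 1) / suc n) * ((+ c) / 1)) (a/b*c/d≡ac/bd 2 1 (suc (2 ℕ.* n)) 1) ⟩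
  (+ (2 ℕ.* suc (2 ℕ.* n))) / (1 ℕ.* 1) * ((+ 1) / suc n) * ((+ c) / 1)
    ≡⟨ cong (_* ((+ c) / 1)) (a/b*c/d≡ac/bd (2 ℕ.* suc (2 ℕ.* n)) (1 ℕ.* 1) 1 (suc n)) ⟩
  (+ (2 ℕ.* suc (2 ℕ.* n) ℕ.* 1)) / (1 ℕ.* 1 ℕ.* suc n) * ((+ c) / 1)
    ≡⟨ a/b*c/d≡ac/bd (2 ℕ.* suc (2 ℕ.* n) ℕ.* 1) (1 ℕ.* 1 ℕ.* suc n) c 1 ⟩
  (+ (2 ℕ.* suc (2 ℕ.* n) ℕ.* 1 ℕ.* c)) / (1 ℕ.* 1 ℕ.* suc n ℕ.* 1)
    ≡⟨ ad≡cb⇒a/b≡c/d (2 ℕ.* suc (2 ℕ.* n) ℕ.* 1 ℕ.* c) (1 ℕ.* 1 ℕ.* suc n ℕ.* 1) b 1 cross ⟩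
  (+ b) / 1 ∎)
  where
  open ≡-Reasoning
  b = 2 ℕ.* suc n C suc n
  c = 2 ℕ.* n C n
  cross : 2 ℕ.* suc (2 ℕ.* n) ℕ.* 1 ℕ.* c ℕ.* 1 ≡ b ℕ.* (1 ℕ.* 1 ℕ.* suc n ℕ.* 1)
  cross = begin
    2 ℕ.* suc (2 ℕ.* n) ℕ.* 1 ℕ.* c ℕ.* 1 ≡⟨ *-identityʳ _ ⟩
    2 ℕ.* suc (2 ℕ.* n) ℕ.* 1 ℕ.* c       ≡⟨ cong (ℕ._* c) (*-identityʳ (2 ℕ.* suc (2 ℕ.* n))) ⟩
    2 ℕ.* suc (2 ℕ.* n) ℕ.* c             ≡⟨ [1+n]*[2+2n]C[1+n]≡2*[1+2n]*[2n]Cn n ⟨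
    suc n ℕ.* b                           ≡⟨ *-comm (suc n) b ⟩
    b ℕ.* suc n                           ≡⟨ cong (b ℕ.*_) (ℕ-Solver.solve (n ∷ [])) ⟩
    b ℕ.* (1 ℕ.* 1 ℕ.* suc n ℕ.* 1)       ∎

x+y*[a-b]≡x : ∀ {x a b} y → a ≡ b → x + y * (a - b) ≡ x
x+y*[a-b]≡x {x} {a} y refl = solve (x ∷ y ∷ a ∷ []) ℚ-ring

-- In the telescoping identities P = 4^{-n}, b = C(2n,n), B = C(2n+2,n+1), H = H_{n+1} (resp. H_{n+2}),
-- and u, v, w, x, M are as above.
telescoping-certificate₁ : ∀ P b H u v w M →
  (+ 5) / 9 - P * ((+ 1) / 3 * u) * b * (H + (+ 2) / 3)
    + (+ 1) / 4 * P * w * ((+ 2) / 1 * M * u * b * v) * (H + v)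
    ≡ (+ 5) / 9 - (+ 1) / 4 * P * ((+ 1) / 3 * v) * ((+ 2) / 1 * M * u * b) * ((H + v) + (+ 2) / 3)
      + (+ 1) / 2 * P * u * b * v * (H + v) * (M * w - 1ℚ)
      + (+ 1) / 6 * P * u * b * (H + v + (+ 2) / 3) * (M * v + (+ 3) / 1 * v - (+ 2) / 1)
telescoping-certificate₁ = solve-∀ ℚ-ring

telescoping-identity₁ : ∀ P b H u v w M {t₁ t₂ B} →
  t₁ ≡ (+ 1) / 3 * u → t₂ ≡ (+ 1) / 3 * v → B ≡ (+ 2) / 1 * M * u * b →
  M * w ≡ 1ℚ → M * v + (+ 3) / 1 * v ≡ (+ 2) / 1 →
  ((+ 5) / 9 - P * t₁ * b * (H + (+ 2) / 3)) + (+ 1) / 4 * P * w * (B * v) * (H + v)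
    ≡ (+ 5) / 9 - (+ 1) / 4 * P * t₂ * B * ((H + v) + (+ 2) / 3)
telescoping-identity₁ P b H u v w M refl refl refl Mw≡1 Mv+3v≡2 =
  trans (telescoping-certificate₁ P b H u v w M)
        (trans (x+y*[a-b]≡x ((+ 1) / 6 * P * u * b * (H + v + (+ 2) / 3)) Mv+3v≡2)
               (x+y*[a-b]≡x ((+ 1) / 2 * P * u * b * v * (H + v)) Mw≡1))

telescoping-certificate₂ : ∀ P b H u v w x M →
  (+ 19) / 100 - P * ((+ 1) / 5 * u * v) * b * (H + (+ 2) / 5)
    + (+ 1) / 4 * P * w * ((+ 2) / 1 * M * u * b * (v * x)) * (H + x)
    ≡ (+ 19) / 100 - (+ 1) / 4 * P * ((+ 1) / 5 * v * x) * ((+ 2) / 1 * M * u * b) * ((H + x) + (+ 2) / 5)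
      + (+ 1) / 2 * P * u * b * v * x * (H + x) * (M * w - 1ℚ)
      + (+ 1) / 10 * P * u * b * x * (H + x + (+ 2) / 5) * (M * v + (+ 3) / 1 * v - (+ 2) / 1)
      + (+ 1) / 5 * P * u * b * (H + x + (+ 2) / 5) * (x + v * x - v)
telescoping-certificate₂ = solve-∀ ℚ-ring

telescoping-identity₂ : ∀ P b H u v w x M {t₁ t₂ s B} →
  t₁ ≡ (+ 1) / 5 * u * v → t₂ ≡ (+ 1) / 5 * v * x → s ≡ v * x → B ≡ (+ 2) / 1 * M * u * b →
  M * w ≡ 1ℚ → M * v + (+ 3) / 1 * v ≡ (+ 2) / 1 → x + v * x ≡ v →
  ((+ 19) / 100 - P * t₁ * b * (H + (+ 2) / 5)) + (+ 1) / 4 * P * w * (B * s) * (H + x)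
    ≡ (+ 19) / 100 - (+ 1) / 4 * P * t₂ * B * ((H + x) + (+ 2) / 5)
telescoping-identity₂ P b H u v w x M refl refl refl refl Mw≡1 Mv+3v≡2 x+vx≡v =
  trans (telescoping-certificate₂ P b H u v w x M)
        (trans (x+y*[a-b]≡x ((+ 1) / 5 * P * u * b * (H + x + (+ 2) / 5)) x+vx≡v)
        (trans (x+y*[a-b]≡x ((+ 1) / 10 * P * u * b * x * (H + x + (+ 2) / 5)) Mv+3v≡2)
               (x+y*[a-b]≡x ((+ 1) / 2 * P * u * b * v * x * (H + x)) Mw≡1)))

Σ₁-telescope : ∀ (t F : ℕ → ℚ) → F 0 ≡ 0ℚ → (∀ n → F n + t (suc n) ≡ F (suc n)) →
               ∀ n → Σ₁ n t ≡ F n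
Σ₁-telescope t F F0≡0 step zero    = sym F0≡0
Σ₁-telescope t F F0≡0 step (suc n) = trans (cong (_+ t (suc n)) (Σ₁-telescope t F F0≡0 step n)) (step n)

closed-form₁ : ℕ → ℚ
closed-form₁ n = (+ 5) / 9 - pow2neg2 n * ((+ 1) / (3 ℕ.* suc n)) * binomℚ (2 ℕ.* n) n * (H (suc n) + (+ 2) / 3)

closed-form₂ : ℕ → ℚ
closed-form₂ n = (+ 19) / 100
  - pow2neg2 n * ((+ 1) / (5 ℕ.* suc n ℕ.* suc (suc n))) * binomℚ (2 ℕ.* n) n * (H (suc (suc n)) + (+ 2) / 5)

closed-form₁-step : ∀ n → closed-form₁ n + term₁ (suc n) ≡ closed-form₁ (suc n)
closed-form₁-step n = telescoping-identity₁ (pow2neg2 n) (binomℚ (2 ℕ.* n) n) (H (suc n))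
  ((+ 1) / suc n) ((+ 1) / suc (suc n)) ((+ 1) / suc (2 ℕ.* n)) ((+ suc (2 ℕ.* n)) / 1)
  (sym (a/b*c/d≡ac/bd 1 3 1 (suc n)))
  (sym (a/b*c/d≡ac/bd 1 3 1 (suc (suc n))))
  (binomℚ[2+2n,1+n]≡2*[1+2n]*binomℚ[2n,n]/[1+n] n)
  ([1+d]*1/[1+d]≡1 (2 ℕ.* n))
  ([1+2n]/[2+n]+3/[2+n]≡2 n)

closed-form₂-step : ∀ n → closed-form₂ n + term₂ (suc n) ≡ closed-form₂ (suc n)
closed-form₂-step n = telescoping-identity₂ (pow2neg2 n) (binomℚ (2 ℕ.* n) n) (H (suc (suc n)))
  ((+ 1) / suc n) ((+ 1) / suc (suc n)) ((+ 1) / suc (2 ℕ.* n)) ((+ 1) / suc (suc (suc n))) ((+ suc (2 ℕ.* n)) / 1)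
  (sym (trans (cong (_* ((+ 1) / suc (suc n))) (a/b*c/d≡ac/bd 1 5 1 (suc n)))
              (a/b*c/d≡ac/bd 1 (5 ℕ.* suc n) 1 (suc (suc n)))))
  (sym (trans (cong (_* ((+ 1) / suc (suc (suc n)))) (a/b*c/d≡ac/bd 1 5 1 (suc (suc n))))
              (a/b*c/d≡ac/bd 1 (5 ℕ.* suc (suc n)) 1 (suc (suc (suc n))))))
  (sym (a/b*c/d≡ac/bd 1 (suc (suc n)) 1 (suc (suc (suc n)))))
  (binomℚ[2+2n,1+n]≡2*[1+2n]*binomℚ[2n,n]/[1+n] n)
  ([1+d]*1/[1+d]≡1 (2 ℕ.* n))
  ([1+2n]/[2+n]+3/[2+n]≡2 n)
  (1/[2+d]+1/[1+d]*1/[2+d]≡1/[1+d] (suc n))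

corollary4p2 : (n : ℕ) → n ≥ 1 →
    (Σ₁ n term₁ ≡ (+ 5) / 9 - pow2neg2 n * ((+ 1) / (3 ℕ.* suc n)) * binomℚ (2 ℕ.* n) n * (H (suc n) + (+ 2) / 3))
      × (Σ₁ n term₂ ≡ (+ 19) / 100 - pow2neg2 n * ((+ 1) / (5 ℕ.* suc n ℕ.* suc (suc n))) * binomℚ (2 ℕ.* n) n * (H (suc (suc n)) + (+ 2) / 5))
corollary4p2 n _ =
  Σ₁-telescope term₁ closed-form₁ refl closed-form₁-step n ,
  Σ₁-telescope term₂ closed-form₂ refl closed-form₂-step n
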